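{- Let $M\in\mathrm{M}_n(\mathbb{Z})$ with $2\mid n$. Then $2\operatorname{Tr}\bigl(\operatorname{adj}(M-M^{\mathsf T})M^{\mathsf T}\bigr)=-n\det(M-M^{\mathsf T})$.
   Context: $\operatorname{adj}$ denotes the adjugate matrix (transpose of the cofactor matrix), satisfying $X\operatorname{adj}(X)=\operatorname{adj}(X)X=\det(X)I$. -}

module Defs where

open import Data.Nat as ℕ using (ℕ; zero; suc)
open import Data.Fin using (Fin; zero; suc; toℕ; punchIn)
open import Data.Integer using (ℤ; +_; _+_; _-_; _*_; -_)

Matrix : ℕ → Set
Matrix n = Fin n → Fin n → ℤ

∑ : ∀ {n} → (Fin n → ℤ) → ℤ
∑ {zero}  f = + 0
∑ {suc n} f = f zero + ∑ (λ i → f (suc i))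

transpose : ∀ {n} → Matrix n → Matrix n
transpose A i j = A j i

_−ᴹ_ : ∀ {n} → Matrix n → Matrix n → Matrix n
(A −ᴹ B) i j = A i j - B i j

_*ᴹ_ : ∀ {n} → Matrix n → Matrix n → Matrix n
(A *ᴹ B) i k = ∑ (λ j → A i j * B j k)

trace : ∀ {n} → Matrix n → ℤ
trace A = ∑ (λ i → A i i)

sign : ℕ → ℤ
sign zero          = + 1
sign (suc zero)    = - (+ 1)
sign (suc (suc k)) = sign k

minor : ∀ {n} → Matrix (suc n) → Fin (suc n) → Fin (suc n) → Matrix n
minor A i j k l = A (punchIn i k) (punchIn j l)

det : ∀ {n} → Matrix n → ℤ
det {zero}  A = + 1
det {suc n} A = ∑ (λ j → sign (toℕ j) * (A zero j * det (minor A zero j)))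

adj : ∀ {n} → Matrix n → Matrix n
adj {zero}  A ()
adj {suc n} A i j = sign (toℕ i ℕ.+ toℕ j) * det (minor A j i)

-- Write A = M − Mᵀ and n = m + 1.  Laplace expansion of det A along each row i
-- says (A · adj A) i i = det A, so trace (A · adj A) = n · det A.  Since A is
-- skew-symmetric, minor A j i = −(minor A i j)ᵀ, and as m is odd this gives
-- det (minor A j i) = −det (minor A i j): adj A is skew-symmetric as well.
-- For any skew-symmetric B, trace ((M − Mᵀ) B) = −2 trace (B Mᵀ); take B = adj A.
--
-- Expansion along
-- row i + 1 is reduced to expansion along row i of the first-row minors; the two
-- double sums over the pair of deleted columns then differ by exchanging the
-- roles of the two columns, which flips the sign.
module Submission where

open import Defs
open import Data.Nat as ℕ using (ℕ; zero; suc)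
open import Data.Nat.Divisibility using (_∣_; divides)
import Data.Nat.Properties as ℕ
open import Data.Fin using (Fin; zero; suc; toℕ; punchIn)
open import Data.Integer using (ℤ; +_; _+_; _-_; _*_; -_)
open import Data.Integer.Properties
  using ( +-commutativeSemigroup; *-commutativeSemigroup; +-*-ring
        ; *-zeroˡ; *-zeroʳ; *-identityˡ; *-identityʳ; *-comm
        ; *-distribˡ-+; neg-distrib-+; neg-involutive; neg-distribʳ-*; suc-*; -1*i≡-i)
open import Data.Integer.Tactic.RingSolver using (solve-∀)
open import Algebra.Properties.CommutativeSemigroup +-commutativeSemigroup
  using () renaming (interchange to +-interchange; x∙yz≈y∙xz to x+[y+z]≡y+[x+z])
open import Algebra.Properties.CommutativeSemigroup *-commutativeSemigroup
  using () renaming (x∙yz≈y∙xz to x*[y*z]≡y*[x*z])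
open import Algebra.Properties.Ring +-*-ring using ([y-z]x≈yx-zx; ⁻¹-anti-homo‿-)
open import Function using (_∘_)
open import Relation.Binary.PropositionalEquality
open ≡-Reasoning

∑-cong : ∀ {n} {f g : Fin n → ℤ} → (∀ i → f i ≡ g i) → ∑ f ≡ ∑ g
∑-cong {zero}  f≗g = refl
∑-cong {suc n} f≗g = cong₂ _+_ (f≗g zero) (∑-cong (f≗g ∘ suc))

∑-const : ∀ n (c : ℤ) → ∑ {n} (λ _ → c) ≡ + n * c
∑-const zero    c = sym (*-zeroˡ c)
∑-const (suc n) c = trans (cong (_+_ c) (∑-const n c)) (sym (suc-* (+ n) c))

∑-distrib-+ : ∀ {n} (f g : Fin n → ℤ) → ∑ (λ i → f i + g i) ≡ ∑ f + ∑ g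
∑-distrib-+ {zero}  f g = refl
∑-distrib-+ {suc n} f g =
  trans (cong (_+_ (f zero + g zero)) (∑-distrib-+ (f ∘ suc) (g ∘ suc)))
        (+-interchange (f zero) (g zero) (∑ (f ∘ suc)) (∑ (g ∘ suc)))

neg-distrib-∑ : ∀ {n} (f : Fin n → ℤ) → - ∑ f ≡ ∑ (λ i → - f i)
neg-distrib-∑ {zero}  f = refl
neg-distrib-∑ {suc n} f =
  trans (neg-distrib-+ (f zero) (∑ (f ∘ suc))) (cong (_+_ (- f zero)) (neg-distrib-∑ (f ∘ suc)))

∑-distrib-- : ∀ {n} (f g : Fin n → ℤ) → ∑ (λ i → f i - g i) ≡ ∑ f - ∑ g
∑-distrib-- f g = trans (∑-distrib-+ f (-_ ∘ g)) (cong (_+_ (∑ f)) (sym (neg-distrib-∑ g)))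

*-distribˡ-∑ : ∀ {n} (c : ℤ) (f : Fin n → ℤ) → c * ∑ f ≡ ∑ (λ i → c * f i)
*-distribˡ-∑ {zero}  c f = *-zeroʳ c
*-distribˡ-∑ {suc n} c f =
  trans (*-distribˡ-+ c (f zero) (∑ (f ∘ suc))) (cong (_+_ (c * f zero)) (*-distribˡ-∑ c (f ∘ suc)))

∑-*-*-∑ : ∀ {m n} (s a : Fin m → ℤ) (g : Fin m → Fin n → ℤ) →
          ∑ (λ j → s j * (a j * ∑ (g j))) ≡ ∑ (λ j → ∑ (λ l → s j * (a j * g j l)))
∑-*-*-∑ s a g = ∑-cong λ j →
  trans (cong (s j *_) (*-distribˡ-∑ (a j) (g j))) (*-distribˡ-∑ (s j) (λ l → a j * g j l))

∑-comm : ∀ {m n} (f : Fin m → Fin n → ℤ) → ∑ (λ i → ∑ (f i)) ≡ ∑ (λ j → ∑ (λ i → f i j))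
∑-comm {zero}  {n} f = sym (trans (∑-const n (+ 0)) (*-zeroʳ (+ n)))
∑-comm {suc m} {n} f =
  trans (cong (_+_ (∑ (f zero))) (∑-comm (f ∘ suc)))
        (sym (∑-distrib-+ (f zero) (λ j → ∑ (λ i → f (suc i) j))))

sign-suc : ∀ k → sign (suc k) ≡ - sign k
sign-suc zero          = refl
sign-suc (suc zero)    = refl
sign-suc (suc (suc k)) = sign-suc k

sign-+ : ∀ m n → sign (m ℕ.+ n) ≡ sign m * sign n
sign-+ zero          n = sym (*-identityˡ (sign n))
sign-+ (suc zero)    n = trans (sign-suc n) (sym (-1*i≡-i (sign n)))
sign-+ (suc (suc m)) n = sign-+ m n

sign-even : ∀ k → sign (k ℕ.* 2) ≡ + 1
sign-even zero    = refl
sign-even (suc k) = sign-even k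

sign-pred-even : ∀ m k → suc m ≡ k ℕ.* 2 → sign m ≡ - + 1
sign-pred-even m k eq = begin
  sign m             ≡⟨ neg-involutive (sign m) ⟨
  - - sign m         ≡⟨ cong -_ (sign-suc m) ⟨
  - sign (suc m)     ≡⟨ cong (-_ ∘ sign) eq ⟩
  - sign (k ℕ.* 2)   ≡⟨ cong -_ (sign-even k) ⟩
  - + 1              ∎

-- The columns j and punchIn j l are distinct; punchBack j l is the l′ with
-- punchIn (punchIn j l) l′ ≡ j, i.e. the same pair of columns listed the other way.
punchBack : ∀ {n} → Fin (suc (suc n)) → Fin (suc n) → Fin (suc n)
punchBack zero            l       = zero
punchBack (suc j)         zero    = j
punchBack {suc n} (suc j) (suc l) = suc (punchBack j l)

punchIn-punchBack : ∀ {n} (j : Fin (suc (suc n))) (l : Fin (suc n)) →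
                    punchIn (punchIn j l) (punchBack j l) ≡ j
punchIn-punchBack zero            l       = refl
punchIn-punchBack (suc j)         zero    = refl
punchIn-punchBack {suc n} (suc j) (suc l) = cong suc (punchIn-punchBack j l)

punchIn²-punchBack : ∀ {n} (j : Fin (suc (suc n))) (l : Fin (suc n)) (k : Fin n) →
                     punchIn (punchIn j l) (punchIn (punchBack j l) k) ≡ punchIn j (punchIn l k)
punchIn²-punchBack zero            l       k       = refl
punchIn²-punchBack (suc j)         zero    k       = refl
punchIn²-punchBack {suc n} (suc j) (suc l) zero    = refl
punchIn²-punchBack {suc n} (suc j) (suc l) (suc k) = cong suc (punchIn²-punchBack j l k)

sign-suc-* : ∀ a b → sign (suc a) * sign (suc b) ≡ sign a * sign b
sign-suc-* a b rewrite sign-suc a | sign-suc b = -x*-y≡x*y (sign a) (sign b)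
  where
  -x*-y≡x*y : ∀ (x y : ℤ) → - x * - y ≡ x * y
  -x*-y≡x*y = solve-∀

sign-punchBack : ∀ {n} (j : Fin (suc (suc n))) (l : Fin (suc n)) →
                 sign (toℕ (punchIn j l)) * sign (toℕ (punchBack j l)) ≡ - (sign (toℕ j) * sign (toℕ l))
sign-punchBack zero            l       = begin
  sign (suc (toℕ l)) * + 1  ≡⟨ *-identityʳ _ ⟩
  sign (suc (toℕ l))        ≡⟨ sign-suc (toℕ l) ⟩
  - sign (toℕ l)            ≡⟨ cong -_ (*-identityˡ _) ⟨
  - (+ 1 * sign (toℕ l))    ∎
sign-punchBack (suc j)         zero    = begin
  + 1 * sign (toℕ j)            ≡⟨ *-identityˡ _ ⟩
  sign (toℕ j)                  ≡⟨ neg-involutive _ ⟨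
  - - sign (toℕ j)              ≡⟨ cong -_ (sign-suc (toℕ j)) ⟨
  - sign (suc (toℕ j))          ≡⟨ cong -_ (*-identityʳ _) ⟨
  - (sign (suc (toℕ j)) * + 1)  ∎
sign-punchBack {suc n} (suc j) (suc l) =
  trans (sign-suc-* (toℕ (punchIn j l)) (toℕ (punchBack j l)))
        (trans (sign-punchBack j l) (cong -_ (sym (sign-suc-* (toℕ j) (toℕ l)))))

∑∑-punchBack : ∀ {n} (F : Fin (suc (suc n)) → Fin (suc n) → ℤ) →
               ∑ (λ j → ∑ (F j)) ≡ ∑ (λ j → ∑ (λ l → F (punchIn j l) (punchBack j l)))
∑∑-punchBack {n} F = begin
  row₀ + ∑ (λ j → F (suc j) zero + inner j)
    ≡⟨ cong (_+_ row₀) (∑-distrib-+ (λ j → F (suc j) zero) inner) ⟩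
  row₀ + (col₀ + ∑ inner)
    ≡⟨ x+[y+z]≡y+[x+z] row₀ col₀ (∑ inner) ⟩
  col₀ + (row₀ + ∑ inner)
    ≡⟨ cong (λ s → col₀ + (row₀ + s)) (∑∑-punchBack-suc n F) ⟩
  col₀ + (row₀ + ∑ inner′)
    ≡⟨ cong (_+_ col₀) (∑-distrib-+ (F zero) inner′) ⟨
  col₀ + ∑ (λ j → F zero j + inner′ j)
    ∎
  where
  row₀ col₀ : ℤ
  row₀ = ∑ (F zero)
  col₀ = ∑ (λ j → F (suc j) zero)

  inner inner′ : Fin (suc n) → ℤ
  inner  j = ∑ (λ l → F (suc j) (suc l))
  inner′ j = ∑ (λ l → F (punchIn (suc j) (suc l)) (punchBack (suc j) (suc l)))

  ∑∑-punchBack-suc : ∀ n (F : Fin (suc (suc n)) → Fin (suc n) → ℤ) →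
                     ∑ (λ j → ∑ {n} (λ l → F (suc j) (suc l)))
                       ≡ ∑ (λ j → ∑ {n} (λ l → F (punchIn (suc j) (suc l)) (punchBack (suc j) (suc l))))
  ∑∑-punchBack-suc zero    F = refl
  ∑∑-punchBack-suc (suc n) F = ∑∑-punchBack (λ j l → F (suc j) (suc l))

det-cong : ∀ {n} {A B : Matrix n} → (∀ r c → A r c ≡ B r c) → det A ≡ det B
det-cong {zero}  A≗B = refl
det-cong {suc n} A≗B = ∑-cong λ j →
  cong₂ (λ a d → sign (toℕ j) * (a * d)) (A≗B zero j)
        (det-cong (λ r c → A≗B (punchIn zero r) (punchIn j c)))

det-expand-row : ∀ {n} (i : Fin (suc n)) (A : Matrix (suc n)) →
                 det A ≡ ∑ (λ j → sign (toℕ i ℕ.+ toℕ j) * (A i j * det (minor A i j)))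
det-expand-row zero            A = refl
det-expand-row {suc n} (suc i) A = begin
  det A
    ≡⟨ ∑-cong (λ j → cong (λ d → sign (toℕ j) * (A zero j * d)) (det-expand-row i (minor A zero j))) ⟩
  ∑ (λ j → sign (toℕ j) * (A zero j * ∑ (minor₀-term j)))
    ≡⟨ ∑-*-*-∑ (sign ∘ toℕ) (A zero) minor₀-term ⟩
  ∑ (λ j → ∑ (F j))
    ≡⟨ ∑-cong (λ j → ∑-cong (G-punchBack j)) ⟨
  ∑ (λ j → ∑ (λ l → G (punchIn j l) (punchBack j l)))
    ≡⟨ ∑∑-punchBack G ⟨
  ∑ (λ c → ∑ (G c))
    ≡⟨ ∑-*-*-∑ (λ c → sign (suc (toℕ i ℕ.+ toℕ c))) (A (suc i)) minorᵢ-term ⟨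
  ∑ (λ c → sign (suc (toℕ i ℕ.+ toℕ c)) * (A (suc i) c * det (minor A (suc i) c)))
    ∎
  where
  D : Fin (suc (suc n)) → Fin (suc n) → ℤ
  D j l = det (minor (minor A zero j) i l)

  minor₀-term minorᵢ-term F G : Fin (suc (suc n)) → Fin (suc n) → ℤ
  minor₀-term j l = sign (toℕ i ℕ.+ toℕ l) * (A (suc i) (punchIn j l) * D j l)
  minorᵢ-term c l = sign (toℕ l) * (A zero (punchIn c l) * det (minor (minor A (suc i) c) zero l))
  F j l = sign (toℕ j) * (A zero j * minor₀-term j l)
  G c l = sign (suc (toℕ i ℕ.+ toℕ c)) * (A (suc i) c * minorᵢ-term c l)

  flip-signs : ∀ (si sc sl′ sj sl a b d : ℤ) → sc * sl′ ≡ - (sj * sl) →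
               - (si * sc) * (b * (sl′ * (a * d))) ≡ sj * (a * (si * sl * (b * d)))
  flip-signs si sc sl′ sj sl a b d sc*sl′≡-sj*sl = begin
    - (si * sc) * (b * (sl′ * (a * d)))   ≡⟨ regroup si sc sl′ a b d ⟩
    - (sc * sl′) * (si * a * b * d)       ≡⟨ cong (λ s → - s * (si * a * b * d)) sc*sl′≡-sj*sl ⟩
    - - (sj * sl) * (si * a * b * d)      ≡⟨ ungroup si sj sl a b d ⟩
    sj * (a * (si * sl * (b * d)))        ∎
    where
    regroup : ∀ (si sc sl′ a b d : ℤ) →
              - (si * sc) * (b * (sl′ * (a * d))) ≡ - (sc * sl′) * (si * a * b * d)
    regroup = solve-∀
    ungroup : ∀ (si sj sl a b d : ℤ) →
              - - (sj * sl) * (si * a * b * d) ≡ sj * (a * (si * sl * (b * d)))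
    ungroup = solve-∀

  G-punchBack : ∀ j l → G (punchIn j l) (punchBack j l) ≡ F j l
  G-punchBack j l = begin
    G c l′
      ≡⟨ cong₂ (λ a d → sign (suc (toℕ i ℕ.+ toℕ c)) * (A (suc i) c * (sign (toℕ l′) * (a * d))))
               (cong (A zero) (punchIn-punchBack j l))
               (det-cong (λ r k → cong (A (suc (punchIn i r))) (punchIn²-punchBack j l k))) ⟩
    sign (suc (toℕ i ℕ.+ toℕ c)) * rest
      ≡⟨ cong (_* rest) (trans (sign-suc (toℕ i ℕ.+ toℕ c)) (cong -_ (sign-+ (toℕ i) (toℕ c)))) ⟩
    - (sign (toℕ i) * sign (toℕ c)) * rest
      ≡⟨ flip-signs (sign (toℕ i)) (sign (toℕ c)) (sign (toℕ l′)) (sign (toℕ j)) (sign (toℕ l))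
                    (A zero j) (A (suc i) c) (D j l) (sign-punchBack j l) ⟩
    sign (toℕ j) * (A zero j * (sign (toℕ i) * sign (toℕ l) * (A (suc i) c * D j l)))
      ≡⟨ cong (λ s → sign (toℕ j) * (A zero j * (s * (A (suc i) c * D j l)))) (sign-+ (toℕ i) (toℕ l)) ⟨
    F j l
      ∎
    where
    c  = punchIn j l
    l′ = punchBack j l
    rest = A (suc i) c * (sign (toℕ l′) * (A zero j * D j l))

-- Expand the first row and, inductively, the first column of its minors; the
-- resulting double sum is the same as the one obtained the other way round.
det-expand-col₀ : ∀ {n} (A : Matrix (suc n)) →
                  det A ≡ ∑ (λ i → sign (toℕ i) * (A i zero * det (minor A i zero)))
det-expand-col₀ {zero}  A = refl
det-expand-col₀ {suc n} A = cong (_+_ (sign 0 * (A zero zero * det (minor A zero zero)))) (begin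
  ∑ (λ l → sign (suc (toℕ l)) * (A zero (suc l) * det (minor A zero (suc l))))
    ≡⟨ ∑-cong (λ l → cong (λ d → sign (suc (toℕ l)) * (A zero (suc l) * d))
                          (det-expand-col₀ (minor A zero (suc l)))) ⟩
  ∑ (λ l → sign (suc (toℕ l)) * (A zero (suc l) * ∑ (λ j → col-term j l)))
    ≡⟨ ∑-*-*-∑ (sign ∘ suc ∘ toℕ) (A zero ∘ suc) (λ l j → col-term j l) ⟩
  ∑ (λ l → ∑ (λ j → sign (suc (toℕ l)) * (A zero (suc l) * col-term j l)))
    ≡⟨ ∑-cong (λ l → ∑-cong (λ j → exchange j l)) ⟩
  ∑ (λ l → ∑ (λ j → sign (suc (toℕ j)) * (A (suc j) zero * row-term j l)))
    ≡⟨ ∑-comm (λ l j → sign (suc (toℕ j)) * (A (suc j) zero * row-term j l)) ⟩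
  ∑ (λ j → ∑ (λ l → sign (suc (toℕ j)) * (A (suc j) zero * row-term j l)))
    ≡⟨ ∑-*-*-∑ (sign ∘ suc ∘ toℕ) (λ j → A (suc j) zero) row-term ⟨
  ∑ (λ j → sign (suc (toℕ j)) * (A (suc j) zero * det (minor A (suc j) zero)))
    ∎)
  where
  D col-term row-term : Fin (suc n) → Fin (suc n) → ℤ
  D j l = det (minor (minor A (suc j) zero) zero l)
  col-term j l = sign (toℕ j) * (A (suc j) zero * D j l)
  row-term j l = sign (toℕ l) * (A zero (suc l) * D j l)

  swap-factors : ∀ (sl sj a b d : ℤ) → - sl * (a * (sj * (b * d))) ≡ - sj * (b * (sl * (a * d)))
  swap-factors = solve-∀

  exchange : ∀ j l → sign (suc (toℕ l)) * (A zero (suc l) * col-term j l)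
                   ≡ sign (suc (toℕ j)) * (A (suc j) zero * row-term j l)
  exchange j l rewrite sign-suc (toℕ l) | sign-suc (toℕ j) =
    swap-factors (sign (toℕ l)) (sign (toℕ j)) (A zero (suc l)) (A (suc j) zero) (D j l)

det-transpose : ∀ {n} (A : Matrix n) → det (transpose A) ≡ det A
det-transpose {zero}  A = refl
det-transpose {suc n} A =
  trans (∑-cong (λ j → cong (λ d → sign (toℕ j) * (A j zero * d)) (det-transpose (minor A j zero))))
        (sym (det-expand-col₀ A))

det-neg : ∀ {n} (A : Matrix n) → det (λ r c → - A r c) ≡ sign n * det A
det-neg {zero}  A = refl
det-neg {suc n} A = begin
  ∑ (λ j → sign (toℕ j) * (- A zero j * det (λ r c → - minor A zero j r c)))
    ≡⟨ ∑-cong (λ j → cong (λ d → sign (toℕ j) * (- A zero j * d)) (det-neg (minor A zero j))) ⟩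
  ∑ (λ j → sign (toℕ j) * (- A zero j * (sign n * det (minor A zero j))))
    ≡⟨ ∑-cong (λ j → pull-out (sign (toℕ j)) (A zero j) (sign n) (det (minor A zero j))) ⟩
  ∑ (λ j → - sign n * (sign (toℕ j) * (A zero j * det (minor A zero j))))
    ≡⟨ *-distribˡ-∑ (- sign n) (λ j → sign (toℕ j) * (A zero j * det (minor A zero j))) ⟨
  - sign n * det A
    ≡⟨ cong (_* det A) (sign-suc n) ⟨
  sign (suc n) * det A
    ∎
  where
  pull-out : ∀ (s a t d : ℤ) → s * (- a * (t * d)) ≡ - t * (s * (a * d))
  pull-out = solve-∀

*ᴹ-adj-diagonal : ∀ {n} (A : Matrix (suc n)) (i : Fin (suc n)) → (A *ᴹ adj A) i i ≡ det A
*ᴹ-adj-diagonal A i = sym (trans (det-expand-row i A) (∑-cong λ j →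
  trans (cong (λ k → sign k * (A i j * det (minor A i j))) (ℕ.+-comm (toℕ i) (toℕ j)))
        (x*[y*z]≡y*[x*z] (sign (toℕ j ℕ.+ toℕ i)) (A i j) (det (minor A i j)))))

trace-*ᴹ-adj : ∀ {n} (A : Matrix (suc n)) → trace (A *ᴹ adj A) ≡ + suc n * det A
trace-*ᴹ-adj {n} A = trans (∑-cong (*ᴹ-adj-diagonal A)) (∑-const (suc n) (det A))

SkewSymmetric : ∀ {n} → Matrix n → Set
SkewSymmetric A = ∀ i j → A j i ≡ - A i j

−ᴹ-transpose-skewSymmetric : ∀ {n} (M : Matrix n) → SkewSymmetric (M −ᴹ transpose M)
−ᴹ-transpose-skewSymmetric M i j = sym (⁻¹-anti-homo‿- (M i j) (M j i))

det-minor-skewSymmetric : ∀ {m} (A : Matrix (suc m)) → sign m ≡ - + 1 → SkewSymmetric A →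
                          ∀ i j → det (minor A j i) ≡ - det (minor A i j)
det-minor-skewSymmetric {m} A m-odd skew i j = begin
  det (minor A j i)
    ≡⟨ det-cong (λ r c → skew (punchIn i c) (punchIn j r)) ⟩
  det (λ r c → - transpose (minor A i j) r c)
    ≡⟨ det-neg (transpose (minor A i j)) ⟩
  sign m * det (transpose (minor A i j))
    ≡⟨ cong₂ _*_ m-odd (det-transpose (minor A i j)) ⟩
  - + 1 * det (minor A i j)
    ≡⟨ -1*i≡-i (det (minor A i j)) ⟩
  - det (minor A i j)
    ∎

adj-skewSymmetric : ∀ {m} (A : Matrix (suc m)) → sign m ≡ - + 1 → SkewSymmetric A →
                    SkewSymmetric (adj A)
adj-skewSymmetric A m-odd skew i j =
  trans (cong₂ _*_ (cong sign (ℕ.+-comm (toℕ j) (toℕ i)))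
                   (det-minor-skewSymmetric A m-odd skew j i))
        (sym (neg-distribʳ-* (sign (toℕ i ℕ.+ toℕ j)) (det (minor A j i))))

trace-−ᴹ-transpose-*ᴹ : ∀ {n} (M B : Matrix n) → SkewSymmetric B →
                        trace ((M −ᴹ transpose M) *ᴹ B) ≡ - (+ 2 * trace (B *ᴹ transpose M))
trace-−ᴹ-transpose-*ᴹ M B skew = begin
  ∑ (λ i → ∑ (λ j → (M i j - M j i) * B j i))
    ≡⟨ ∑-cong (λ i → ∑-cong (λ j → [y-z]x≈yx-zx (B j i) (M i j) (M j i))) ⟩
  ∑ (λ i → ∑ (λ j → M i j * B j i - M j i * B j i))
    ≡⟨ ∑-cong (λ i → ∑-distrib-- (λ j → M i j * B j i) (λ j → M j i * B j i)) ⟩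
  ∑ (λ i → ∑ (λ j → M i j * B j i) - ∑ (λ j → M j i * B j i))
    ≡⟨ ∑-distrib-- (λ i → ∑ (λ j → M i j * B j i)) (λ i → ∑ (λ j → M j i * B j i)) ⟩
  ∑ (λ i → ∑ (λ j → M i j * B j i)) - ∑ (λ i → ∑ (λ j → M j i * B j i))
    ≡⟨ cong₂ _-_ skew-half transposed-half ⟩
  - T - T
    ≡⟨ -x-x≡-[2*x] T ⟩
  - (+ 2 * T)
    ∎
  where
  T : ℤ
  T = trace (B *ᴹ transpose M)

  skew-half : ∑ (λ i → ∑ (λ j → M i j * B j i)) ≡ - T
  skew-half = begin
    ∑ (λ i → ∑ (λ j → M i j * B j i))
      ≡⟨ ∑-cong (λ i → ∑-cong (λ j → begin
           M i j * B j i      ≡⟨ cong (M i j *_) (skew i j) ⟩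
           M i j * - B i j    ≡⟨ neg-distribʳ-* (M i j) (B i j) ⟨
           - (M i j * B i j)  ≡⟨ cong -_ (*-comm (M i j) (B i j)) ⟩
           - (B i j * M i j)  ∎)) ⟩
    ∑ (λ i → ∑ (λ j → - (B i j * M i j)))
      ≡⟨ ∑-cong (λ i → neg-distrib-∑ (λ j → B i j * M i j)) ⟨
    ∑ (λ i → - ∑ (λ j → B i j * M i j))
      ≡⟨ neg-distrib-∑ (λ i → ∑ (λ j → B i j * M i j)) ⟨
    - T
      ∎

  transposed-half : ∑ (λ i → ∑ (λ j → M j i * B j i)) ≡ T
  transposed-half =
    trans (∑-comm (λ i j → M j i * B j i)) (∑-cong (λ j → ∑-cong (λ i → *-comm (M j i) (B j i))))

  -x-x≡-[2*x] : ∀ (x : ℤ) → - x - x ≡ - (+ 2 * x)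
  -x-x≡-[2*x] = solve-∀

lemma3p10 : (n : ℕ) → 2 ∣ n → (M : Matrix n) →
            + 2 * trace (adj (M −ᴹ transpose M) *ᴹ transpose M)
              ≡ - (+ n * det (M −ᴹ transpose M))
lemma3p10 zero    _              M = refl
lemma3p10 (suc m) (divides k eq) M = begin
  + 2 * trace (adj A *ᴹ transpose M)         ≡⟨ neg-involutive _ ⟨
  - - (+ 2 * trace (adj A *ᴹ transpose M))   ≡⟨ cong -_ (trace-−ᴹ-transpose-*ᴹ M (adj A) adj-A-skew) ⟨
  - trace (A *ᴹ adj A)                       ≡⟨ cong -_ (trace-*ᴹ-adj A) ⟩
  - (+ suc m * det A)                        ∎
  where
  A : Matrix (suc m)
  A = M −ᴹ transpose M

  adj-A-skew : SkewSymmetric (adj A)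
  adj-A-skew = adj-skewSymmetric A (sign-pred-even m k eq) (−ᴹ-transpose-skewSymmetric M)
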